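{- For every arc $\alpha=(a,b,A,B)\in\mathcal A_n$, the matroid polytope of the shard matroid $M_\alpha$ (the cycle matroid of the multigraph $\Gamma_\alpha$) is the translated shard polytope $\overrightarrow{\mathrm{SP}}(\alpha):=\mathrm{SP}(\alpha)+\mathbf 1_{B\cup\{b\}}$.
   Context: $]a,b[=\{a+1,\dots,b-1\}$, $(\mathbf e_i)$ the standard basis of $\mathbb R^n$, $\mathbf 1_X=\sum_{i\in X}\mathbf e_i$. An arc is a quadruple $\alpha=(a,b,A,B)$ with $1\le a<b\le n$ and $A\sqcup B=]a,b[$. An $\alpha$-alternating matching is a (possibly empty) set $M=\{a_1<b_1<\dots<a_k<b_k\}$ with $a\le a_1$, $b_k\le b$, $a_i\in\{a\}\cup A$, $b_i\in B\cup\{b\}$; $\chi(M)=\sum_i(\mathbf e_{a_i}-\mathbf e_{b_i})$; $\mathrm{SP}(\alpha)=\mathrm{conv}\{\chi(M)\}$. Write $\{a\}\cup A=\{a_1<\dots<a_{|A|+1}\}$ (so $a_1=a$) and $B\cup\{b\}=\{b_1<\dots<b_{|B|+1}\}$ (so $b_{|B|+1}=b$), and set $b_0=a-1$. The shard graph $\Gamma_\alpha$ is the multigraph on vertex set $\{0,1,\dots,|B|+1\}$ with edges labeled by $[n]$: for each $1\le i\le|A|+1$, an edge labeled $a_i$ joining vertex $k$ to vertex $|B|+1$, where $0\le k\le|B|$ is such that $b_k<a_i<b_{k+1}$; for each $1\le j\le|B|+1$, an edge labeled $b_j$ joining vertex $j-1$ to vertex $j$; and for each $k\in[n]\setminus[a,b]$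 a loop labeled $k$ at vertex $|B|+1$. The shard matroid $M_\alpha$ is the cycle matroid of $\Gamma_\alpha$ on ground set $[n]$ (bases = label sets of spanning trees). The matroid polytope of a matroid on $[n]$ is $\mathrm{conv}\{\mathbf 1_X: X\text{ a basis}\}$.
   Formalization: The polytope equality is stated only for points of ℚ^n rather than ℝ^n, with both convex hulls formed from rational convex weights. -}

module Defs where

open import Data.Nat as ℕ using (ℕ; zero; suc)
open import Data.Fin as F using (Fin; toℕ)
open import Data.Fin.Subset using (Subset; _∈_; _-_; ∣_∣)
open import Data.Bool using (Bool; true; false; if_then_else_)
open import Data.Vec using (lookup)
open import Data.List using (List; []; _∷_; map; filter; length)
open import Data.List.Relation.Unary.All using (All)
open import Data.Rational as Q using (ℚ; 0ℚ; 1ℚ)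
open import Data.Product using (Σ; ∃; _×_; _,_; proj₁; proj₂)
open import Data.Sum using (_⊎_)
open import Data.Empty using (⊥)
open import Data.Unit using (⊤)
open import Function.Bundles using (_⇔_)
open import Relation.Nullary using (¬_; yes; no)
open import Relation.Binary.PropositionalEquality using (_≡_)

-- Convention: the element i : Fin n stands for the integer (toℕ i + 1) ∈ [n];
-- this shift is order-preserving, so all order conditions are stated via Fin's _<_ / _≤_.

record Arc (n : ℕ) : Set where
  field
    a b      : Fin n
    a<b      : a F.< b
    A B      : Subset n
    cover    : ∀ i → (i ∈ A ⊎ i ∈ B) ⇔ (a F.< i × i F.< b)
    disjoint : ∀ i → i ∈ A → i ∈ B → ⊥
open Arc public

Point : ℕ → Set
Point n = Fin n → ℚ

e : ∀ {n} → Fin n → Point n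
e i j with i F.≟ j
... | yes _ = 1ℚ
... | no  _ = 0ℚ

𝟏 : ∀ {n} → Subset n → Point n
𝟏 X j = if lookup X j then 1ℚ else 0ℚ

Conv : ∀ {n} → (Point n → Set) → Point n → Set
Conv {n} S x =
  Σ (List (ℚ × Point n)) λ ws →
    All (λ wp → (0ℚ Q.≤ proj₁ wp) × S (proj₂ wp)) ws
    × (Data.List.foldr Q._+_ 0ℚ (map proj₁ ws) ≡ 1ℚ)
    × (∀ j → x j ≡ Data.List.foldr Q._+_ 0ℚ (map (λ wp → proj₁ wp Q.* proj₂ wp j) ws))

ASide : ∀ {n} → Arc n → Fin n → Set
ASide α i = (i ≡ a α) ⊎ (i ∈ A α)

BSide : ∀ {n} → Arc n → Fin n → Set
BSide α i = (i ∈ B α) ⊎ (i ≡ b α)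

data AltFrom {n} (α : Arc n) : ℕ → List (Fin n × Fin n) → Set where
  []  : ∀ {lo} → AltFrom α lo []
  _∷_ : ∀ {lo x y ps} →
        (lo ℕ.≤ toℕ x) × (a α F.≤ x) × (x F.< y) × (y F.≤ b α) × ASide α x × BSide α y →
        AltFrom α (suc (toℕ y)) ps →
        AltFrom α lo ((x , y) ∷ ps)

IsAltMatching : ∀ {n} → Arc n → List (Fin n × Fin n) → Set
IsAltMatching α ps = AltFrom α 0 ps

χ : ∀ {n} → List (Fin n × Fin n) → Point n
χ []             j = 0ℚ
χ ((x , y) ∷ ps) j = (e x j Q.- e y j) Q.+ χ ps j

SP : ∀ {n} → Arc n → Point n → Set
SP α = Conv (λ p → Σ _ λ ps → IsAltMatching α ps × (∀ j → p j ≡ χ ps j))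

BbSet : ∀ {n} → Arc n → Subset n
BbSet α = Data.Vec.tabulate λ j → if lookup (B α) j then true else
                                   (if toℕ j ℕ.≡ᵇ toℕ (b α) then true else false)

SPtrans : ∀ {n} → Arc n → Point n → Set
SPtrans α x = Σ _ λ y → SP α y × (∀ j → x j ≡ y j Q.+ 𝟏 (BbSet α) j)

-- The shard graph Γ_α, vertex set {0,…,|B|+1}, edges labelled by [n]

countBelow : ∀ {n} → Subset n → Fin n → ℕ
countBelow {n} X i = length (filter (λ j → (toℕ j ℕ.<? toℕ i)) (filter (λ j → lookup X j Data.Bool.≟ true) (Data.List.allFin n)))
  where import Data.Bool

top : ∀ {n} → Arc n → ℕ
top α = suc ∣ B α ∣

-- endpoints of the edge labelled i.
-- * i ∉ [a,b]           : loop at |B|+1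
-- * i ∈ {a} ∪ A          : edge k — |B|+1 where b_k < i < b_{k+1}, i.e. k = #{ j ∈ B : j < i }
-- * i = b_j ∈ B ∪ {b}    : edge (j-1) — j, and j-1 = #{ x ∈ B : x < b_j }
ends : ∀ {n} → Arc n → Fin n → ℕ × ℕ
ends α i with i F.<? a α | b α F.<? i
... | yes _ | _     = top α , top α
... | no _  | yes _ = top α , top α
... | no _  | no _ with i F.≟ a α | i F.≟ b α | lookup (B α) i
...   | yes _ | _     | _     = countBelow (B α) i , top α
...   | no _  | yes _ | _     = countBelow (B α) i , suc (countBelow (B α) i)
...   | no _  | no _  | true  = countBelow (B α) i , suc (countBelow (B α) i)
...   | no _  | no _  | false = countBelow (B α) i , top α

data Conn {n} (α : Arc n) (X : Subset n) : ℕ → ℕ → Set where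
  here : ∀ {u} → Conn α X u u
  fwd  : ∀ {w} i → i ∈ X → Conn α X (proj₂ (ends α i)) w → Conn α X (proj₁ (ends α i)) w
  bwd  : ∀ {w} i → i ∈ X → Conn α X (proj₁ (ends α i)) w → Conn α X (proj₂ (ends α i)) w

-- X is (the label set of) a spanning tree of Γ_α: the subgraph with edges X is
-- connected on all vertices {0,…,|B|+1} and acyclic (every edge of X is a bridge,
-- i.e. its endpoints are disconnected once it is removed; this excludes loops and
-- parallel edges).
IsSpanningTree : ∀ {n} → Arc n → Subset n → Set
IsSpanningTree α X =
  (∀ v → v ℕ.≤ top α → Conn α X 0 v)
  × (∀ i → i ∈ X → ¬ Conn α (X - i) (proj₁ (ends α i)) (proj₂ (ends α i)))

IsBasis : ∀ {n} → Arc n → Subset n → Set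
IsBasis = IsSpanningTree

MatroidPolytope : ∀ {n} → Arc n → Point n → Set
MatroidPolytope {n} α = Conv (λ p → Σ (Subset n) λ X → IsBasis α X × (∀ j → p j ≡ 𝟏 X j))

-- Both polytopes are convex hulls, and their vertex sets differ by the translation
-- 𝟏_{B∪{b}}. For a label set X call the elements of ({a} ∪ A) ∩ X its openers and those of
-- (B ∪ {b}) ∖ X its closers. X is a spanning tree of Γ_α exactly when X ⊆ [a,b] and, from
-- left to right, openers and closers alternate, starting with an opener and ending with a
-- closer. Pairing every opener with the next closer then gives an α-alternating matching M
-- with 𝟏_X = χ(M) + 𝟏_{B∪{b}}, and conversely every M arises from the set X_M of its first
-- elements together with the elements of B ∪ {b} that are not second elements of M. The tree
-- criterion is proved with invariants of walks in Γ_α, whose vertex for a label i is its level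
-- #{j ∈ B : j < i}: the b-labels form the path 0 — 1 — ⋯ — |B|+1, and an a-label joins its
-- level to |B|+1.

module Submission where

open import Defs
open import Data.Nat as ℕ using (ℕ; zero; suc; _+_; _∸_; _≤_; _<_; _≤?_; _<?_; z≤n; s≤s; s≤s⁻¹)
open import Data.Nat.Properties
open import Data.Fin as F using (Fin; toℕ)
open import Data.Fin.Properties using (toℕ-injective; toℕ<n; toℕ-fromℕ<; toℕ-inject; any?; all?; ¬∀⟶∃¬-smallest)
  renaming (<⇒≢ to <⇒≢ᶠ)
open import Data.Fin.Subset using (Subset; _∈_; _∉_; ∣_∣; ⁅_⁆; _─_; _-_)
open import Data.Fin.Subset.Properties using (_∈?_; x∈⁅x⁆; p─q⊆p; x∈p∧x≢y⇒x∈p-y)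
open import Data.Bool using (Bool; true; false)
open import Data.Bool.Properties using (T-≡)
import Data.Bool as Bool
open import Data.Vec using (Vec; []; _∷_; lookup; here; there)
import Data.Vec as Vec
open import Data.Vec.Properties using ([]=⇒lookup; lookup⇒[]=; lookup∘tabulate)
open import Data.List using (List; []; _∷_; map; filter; length; allFin; foldr)
open import Data.List.Properties using (map-tabulate; length-map; filter-≐; filter-none)
import Data.List.Relation.Unary.All as All
open import Data.List.Relation.Unary.All.Properties using (map⁺)
open import Data.List.Relation.Unary.Any using (Any; here; there)
import Data.List.Relation.Unary.Any as Any
open import Data.Rational as Q using (ℚ; 0ℚ; 1ℚ)
import Data.Rational.Properties as QP
open import Data.Rational.Solver using (module +-*-Solver)
open import Data.Product using (Σ; ∃; _×_; _,_; proj₁; proj₂)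
open import Data.Sum using (_⊎_; inj₁; inj₂)
open import Data.Empty using (⊥; ⊥-elim)
open import Relation.Nullary using (¬_; yes; no; does; Dec)
open import Relation.Nullary.Decidable using (_×-dec_; ¬?; decidable-stable)
open import Relation.Unary using (Decidable)
open import Relation.Binary.PropositionalEquality
open import Relation.Binary.Definitions using (tri<; tri≈; tri>)
open import Function using (_∘_; id)
open import Function.Bundles using (_⇔_; mk⇔; Equivalence)

count< : ∀ {m} → Vec Bool m → ℕ → ℕ
count< _           zero    = 0
count< []          (suc p) = 0
count< (true  ∷ X) (suc p) = suc (count< X p)
count< (false ∷ X) (suc p) = count< X p

filter-map : ∀ {A C : Set} {P : C → Set} (P? : Decidable P) (g : A → C) (xs : List A) →
             filter P? (map g xs) ≡ map g (filter (P? ∘ g) xs)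
filter-map P? g [] = refl
filter-map P? g (x ∷ xs) with does (P? (g x))
... | true  = cong (g x ∷_) (filter-map P? g xs)
... | false = filter-map P? g xs

private
  below? : ∀ {m} (k : ℕ) → Decidable (λ (j : Fin m) → toℕ j < k)
  below? k j = toℕ j <? k

  marked? : ∀ {m} (X : Vec Bool m) → Decidable (λ j → lookup X j ≡ true)
  marked? X j = lookup X j Bool.≟ true

  marked-tail : ∀ {m} x (X : Vec Bool m) →
                filter (marked? (x ∷ X)) (Data.List.tabulate F.suc) ≡ map F.suc (filter (marked? X) (allFin m))
  marked-tail {m} x X = trans (cong (filter (marked? (x ∷ X))) (sym (map-tabulate id F.suc)))
                              (filter-map (marked? (x ∷ X)) F.suc (allFin m))

countBelow-count< : ∀ {m} (X : Vec Bool m) k →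
                    length (filter (below? k) (filter (marked? X) (allFin m))) ≡ count< X k
count<-shifted : ∀ {m} (X : Vec Bool m) k →
                 length (filter (below? k) (map F.suc (filter (marked? X) (allFin m)))) ≡ count< X (ℕ.pred k)

count<-shifted {m} X zero =
  cong length (filter-none (below? 0) {map F.suc (filter (marked? X) (allFin m))} (All.universal (λ _ ()) _))
count<-shifted X (suc k) = begin
    length (filter (below? (suc k)) (map F.suc L))          ≡⟨ cong length (filter-map (below? (suc k)) F.suc L) ⟩
    length (map F.suc (filter (below? (suc k) ∘ F.suc) L))  ≡⟨ length-map F.suc (filter _ L) ⟩
    length (filter (below? (suc k) ∘ F.suc) L)              ≡⟨ cong length (filter-≐ _ (below? k) (s≤s⁻¹ , s≤s) L) ⟩
    length (filter (below? k) L)                            ≡⟨ countBelow-count< X k ⟩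
    count< X k                                              ∎
  where
  open ≡-Reasoning
  L = filter (marked? X) (allFin _)

countBelow-count< []          zero    = refl
countBelow-count< []          (suc k) = refl
countBelow-count< (true  ∷ X) zero    rewrite marked-tail true  X = count<-shifted X zero
countBelow-count< (true  ∷ X) (suc k) rewrite marked-tail true  X = cong suc (count<-shifted X (suc k))
countBelow-count< (false ∷ X) zero    rewrite marked-tail false X = count<-shifted X zero
countBelow-count< (false ∷ X) (suc k) rewrite marked-tail false X = count<-shifted X (suc k)

count<-mono : ∀ {m} (X : Subset m) {p q} → p ≤ q → count< X p ≤ count< X q
count<-mono X           {zero}  _         = z≤n
count<-mono []          {suc p} (s≤s _)   = z≤n
count<-mono (true  ∷ X) {suc p} (s≤s p≤q) = s≤s (count<-mono X p≤q)
count<-mono (false ∷ X) {suc p} (s≤s p≤q) = count<-mono X p≤q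

count<-strict : ∀ {m} {X : Subset m} {i p} → i ∈ X → toℕ i < p → count< X (toℕ i) < count< X p
count<-strict                 here        (s≤s _)  = s≤s z≤n
count<-strict {X = true  ∷ _} (there i∈X) (s≤s lt) = s≤s (count<-strict i∈X lt)
count<-strict {X = false ∷ _} (there i∈X) (s≤s lt) = count<-strict i∈X lt

count<≤∣∣ : ∀ {m} (X : Subset m) p → count< X p ≤ ∣ X ∣
count<≤∣∣ X           zero    = z≤n
count<≤∣∣ []          (suc p) = z≤n
count<≤∣∣ (true  ∷ X) (suc p) = s≤s (count<≤∣∣ X p)
count<≤∣∣ (false ∷ X) (suc p) = count<≤∣∣ X p

count<-∣∣ : ∀ {m} (X : Subset m) p → (∀ {i} → i ∈ X → toℕ i < p) → count< X p ≡ ∣ X ∣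
count<-∣∣ []          zero    _    = refl
count<-∣∣ []          (suc p) _    = refl
count<-∣∣ (true  ∷ X) zero    all< = ⊥-elim (n≮0 (all< here))
count<-∣∣ (false ∷ X) zero    all< = count<-∣∣ X 0 (⊥-elim ∘ n≮0 ∘ all< ∘ there)
count<-∣∣ (true  ∷ X) (suc p) all< = cong suc (count<-∣∣ X p (s≤s⁻¹ ∘ all< ∘ there))
count<-∣∣ (false ∷ X) (suc p) all< = count<-∣∣ X p (s≤s⁻¹ ∘ all< ∘ there)

count<-surjective : ∀ {m} (X : Subset m) k → k < ∣ X ∣ → ∃ λ i → i ∈ X × count< X (toℕ i) ≡ k
count<-surjective (true  ∷ X) zero    _ = F.zero , here , refl
count<-surjective (true  ∷ X) (suc k) (s≤s k<) with count<-surjective X k k<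
... | i , i∈X , eq = F.suc i , there i∈X , cong suc eq
count<-surjective (false ∷ X) k       k< with count<-surjective X k k<
... | i , i∈X , eq = F.suc i , there i∈X , eq

true≢false : true ≢ false
true≢false ()

x∈p─q⇒x∉q : ∀ {m} {x : Fin m} (p q : Subset m) → x ∈ p ─ q → x ∉ q
x∈p─q⇒x∉q (_ ∷ p) (true  ∷ q) (there x∈) (there x∈q) = x∈p─q⇒x∉q p q x∈ x∈q
x∈p─q⇒x∉q (_ ∷ p) (false ∷ q) (there x∈) (there x∈q) = x∈p─q⇒x∉q p q x∈ x∈q

x∈p-y⇒x≢y : ∀ {m} {x y : Fin m} (p : Subset m) → x ∈ p - y → x ≢ y
x∈p-y⇒x≢y {y = y} p x∈ refl = x∈p─q⇒x∉q p ⁅ y ⁆ x∈ (x∈⁅x⁆ y)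

x∈p-y⇒x∈p : ∀ {m} {x y : Fin m} (p : Subset m) → x ∈ p - y → x ∈ p
x∈p-y⇒x∈p {y = y} p = p─q⊆p p ⁅ y ⁆

𝟏-∈ : ∀ {n} {X : Subset n} {j} → j ∈ X → 𝟏 X j ≡ 1ℚ
𝟏-∈ j∈X rewrite []=⇒lookup j∈X = refl

𝟏-∉ : ∀ {n} {X : Subset n} {j} → j ∉ X → 𝟏 X j ≡ 0ℚ
𝟏-∉ {X = X} {j} j∉X with lookup X j in eq
... | true  = ⊥-elim (j∉X (lookup⇒[]= j X eq))
... | false = refl

e-diag : ∀ {n} (i : Fin n) → e i i ≡ 1ℚ
e-diag i with i F.≟ i
... | yes _  = refl
... | no i≢i = ⊥-elim (i≢i refl)

e-off : ∀ {n} {i j : Fin n} → i ≢ j → e i j ≡ 0ℚ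
e-off {i = i} {j} i≢j with i F.≟ j
... | yes i≡j = ⊥-elim (i≢j i≡j)
... | no _    = refl

weight : ∀ {n} → List (ℚ × Point n) → ℚ
weight ws = foldr Q._+_ 0ℚ (map proj₁ ws)

combination : ∀ {n} → List (ℚ × Point n) → Point n
combination ws j = foldr Q._+_ 0ℚ (map (λ wp → proj₁ wp Q.* proj₂ wp j) ws)

translate : ∀ {n} → Point n → ℚ × Point n → ℚ × Point n
translate d (w , p) = w , λ j → p j Q.+ d j

weight-translate : ∀ {n} (d : Point n) ws → weight (map (translate d) ws) ≡ weight ws
weight-translate d []             = refl
weight-translate d ((w , _) ∷ ws) = cong (w Q.+_) (weight-translate d ws)

combination-translate : ∀ {n} (d : Point n) ws j →
  combination (map (translate d) ws) j ≡ combination ws j Q.+ weight ws Q.* d j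
combination-translate d [] j = sym (trans (QP.+-identityˡ (0ℚ Q.* d j)) (QP.*-zeroˡ (d j)))
combination-translate d ((w , p) ∷ ws) j rewrite combination-translate d ws j =
  solve 5 (λ w p x r s → w :* (p :+ x) :+ (r :+ s :* x) := (w :* p :+ r) :+ (w :+ s) :* x)
        refl w (p j) (d j) (combination ws j) (weight ws)
  where open +-*-Solver

Conv-translate : ∀ {n} {S S′ : Point n → Set} (d : Point n) →
  (∀ {p} → S p → S′ (λ j → p j Q.+ d j)) →
  ∀ {x y} → Conv S x → (∀ j → y j ≡ x j Q.+ d j) → Conv S′ y
Conv-translate {S = S} {S′} d S⇒S′ {x} {y} (ws , ws-valid , ws-sum , x≡) y≡ =
  map (translate d) ws , map⁺ (All.map valid ws-valid) , trans (weight-translate d ws) ws-sum , y≡comb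
  where
  valid : ∀ {wp} → (0ℚ Q.≤ proj₁ wp) × S (proj₂ wp) →
          (0ℚ Q.≤ proj₁ (translate d wp)) × S′ (proj₂ (translate d wp))
  valid (0≤w , Sp) = 0≤w , S⇒S′ Sp
  y≡comb : ∀ j → y j ≡ combination (map (translate d) ws) j
  y≡comb j = begin
      y j                                    ≡⟨ y≡ j ⟩
      x j Q.+ d j                            ≡⟨ cong₂ Q._+_ (x≡ j) (sym (QP.*-identityˡ (d j))) ⟩
      combination ws j Q.+ 1ℚ Q.* d j        ≡⟨ cong (λ s → combination ws j Q.+ s Q.* d j) (sym ws-sum) ⟩
      combination ws j Q.+ weight ws Q.* d j ≡⟨ sym (combination-translate d ws j) ⟩
      combination (map (translate d) ws) j   ∎
    where open ≡-Reasoning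

module _ {n : ℕ} {P : Fin n → Set} (P? : Decidable P) (lo : ℕ) where
  private
    Starts : Fin n → Set
    Starts j = lo ≤ toℕ j × P j

    starts? : Decidable Starts
    starts? j = lo ≤? toℕ j ×-dec P? j

    inject-fromℕ< : ∀ {i j : Fin n} (j<i : toℕ j < toℕ i) → F.inject (F.fromℕ< j<i) ≡ j
    inject-fromℕ< j<i = toℕ-injective (trans (toℕ-inject (F.fromℕ< j<i)) (toℕ-fromℕ< j<i))

  first-from : (∀ j → lo ≤ toℕ j → ¬ P j) ⊎
               ∃ λ i → lo ≤ toℕ i × P i × (∀ j → lo ≤ toℕ j → toℕ j < toℕ i → ¬ P j)
  first-from with all? (¬? ∘ starts?)
  ... | yes none = inj₁ λ j lo≤j Pj → none j (lo≤j , Pj)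
  ... | no some with ¬∀⟶∃¬-smallest n (¬_ ∘ Starts) (¬? ∘ starts?) some
  ...   | i , ¬¬starts , earlier with decidable-stable (starts? i) ¬¬starts
  ...     | lo≤i , Pi = inj₂ (i , lo≤i , Pi , λ j lo≤j j<i Pj →
                          earlier (F.fromℕ< j<i) (subst Starts (sym (inject-fromℕ< j<i)) (lo≤j , Pj)))

module _ {n : ℕ} (α : Arc n) where
  open Equivalence

  level : Fin n → ℕ
  level = countBelow (B α)

  level≡count< : ∀ i → level i ≡ count< (B α) (toℕ i)
  level≡count< i = countBelow-count< (B α) (toℕ i)

  A⇒inside : ∀ {i} → i ∈ A α → toℕ (a α) < toℕ i × toℕ i < toℕ (b α)
  A⇒inside i∈A = to (cover α _) (inj₁ i∈A)

  B⇒inside : ∀ {i} → i ∈ B α → toℕ (a α) < toℕ i × toℕ i < toℕ (b α)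
  B⇒inside i∈B = to (cover α _) (inj₂ i∈B)

  ASide-bounds : ∀ {i} → ASide α i → toℕ (a α) ≤ toℕ i × toℕ i < toℕ (b α)
  ASide-bounds (inj₁ refl) = ≤-refl , a<b α
  ASide-bounds (inj₂ i∈A)  = <⇒≤ (proj₁ (A⇒inside i∈A)) , proj₂ (A⇒inside i∈A)

  BSide-bounds : ∀ {i} → BSide α i → toℕ (a α) < toℕ i × toℕ i ≤ toℕ (b α)
  BSide-bounds (inj₁ i∈B) = proj₁ (B⇒inside i∈B) , <⇒≤ (proj₂ (B⇒inside i∈B))
  BSide-bounds (inj₂ refl) = a<b α , ≤-refl

  ASide⇒¬BSide : ∀ {i} → ASide α i → ¬ BSide α i
  ASide⇒¬BSide (inj₁ refl) s           = <-irrefl refl (proj₁ (BSide-bounds s))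
  ASide⇒¬BSide (inj₂ i∈A)  (inj₁ i∈B)  = disjoint α _ i∈A i∈B
  ASide⇒¬BSide (inj₂ i∈A)  (inj₂ refl) = <-irrefl refl (proj₂ (A⇒inside i∈A))

  ASide⊎BSide : ∀ i → toℕ (a α) ≤ toℕ i → toℕ i ≤ toℕ (b α) → ASide α i ⊎ BSide α i
  ASide⊎BSide i a≤i i≤b with toℕ (a α) ≟ toℕ i | toℕ i ≟ toℕ (b α)
  ... | yes a≡i | _       = inj₁ (inj₁ (toℕ-injective (sym a≡i)))
  ... | no _    | yes i≡b = inj₂ (inj₂ (toℕ-injective i≡b))
  ... | no a≢i  | no i≢b with from (cover α i) (≤∧≢⇒< a≤i a≢i , ≤∧≢⇒< i≤b i≢b)
  ...   | inj₁ i∈A = inj₁ (inj₂ i∈A)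
  ...   | inj₂ i∈B = inj₂ (inj₁ i∈B)

  ASide? : Decidable (ASide α)
  ASide? i with i F.≟ a α | i ∈? A α
  ... | yes i≡a | _       = yes (inj₁ i≡a)
  ... | no _    | yes i∈A = yes (inj₂ i∈A)
  ... | no i≢a  | no i∉A  = no λ { (inj₁ i≡a) → i≢a i≡a ; (inj₂ i∈A) → i∉A i∈A }

  BSide? : Decidable (BSide α)
  BSide? i with i ∈? B α | i F.≟ b α
  ... | yes i∈B | _       = yes (inj₁ i∈B)
  ... | no _    | yes i≡b = yes (inj₂ i≡b)
  ... | no i∉B  | no i≢b  = no λ { (inj₁ i∈B) → i∉B i∈B ; (inj₂ i≡b) → i≢b i≡b }

  level-mono : ∀ {i j} → toℕ i ≤ toℕ j → level i ≤ level j
  level-mono {i} {j} i≤j rewrite level≡count< i | level≡count< j = count<-mono (B α) i≤j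

  level≤∣B∣ : ∀ i → level i ≤ ∣ B α ∣
  level≤∣B∣ i rewrite level≡count< i = count<≤∣∣ (B α) (toℕ i)

  level<top : ∀ i → level i < top α
  level<top i = s≤s (level≤∣B∣ i)

  level-b : level (b α) ≡ ∣ B α ∣
  level-b rewrite level≡count< (b α) = count<-∣∣ (B α) (toℕ (b α)) (proj₂ ∘ B⇒inside)

  level<⇒< : ∀ {i j} → level i < level j → toℕ i < toℕ j
  level<⇒< {i} {j} lt = ≰⇒> (λ j≤i → <⇒≱ lt (level-mono j≤i))

  level-strict : ∀ {q j} → BSide α q → toℕ q < toℕ j → toℕ j ≤ toℕ (b α) → level q < level j
  level-strict {q} {j} (inj₁ q∈B) q<j _ rewrite level≡count< q | level≡count< j = count<-strict q∈B q<j
  level-strict (inj₂ refl) b<j j≤b = ⊥-elim (<⇒≱ b<j j≤b)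

  level-injective : ∀ {q q′} → BSide α q → BSide α q′ → level q ≡ level q′ → q ≡ q′
  level-injective {q} {q′} s s′ eq with <-cmp (toℕ q) (toℕ q′)
  ... | tri< q<q′ _ _ = ⊥-elim (<-irrefl eq (level-strict s q<q′ (proj₂ (BSide-bounds s′))))
  ... | tri≈ _ q≡q′ _ = toℕ-injective q≡q′
  ... | tri> _ _ q′<q = ⊥-elim (<-irrefl (sym eq) (level-strict s′ q′<q (proj₂ (BSide-bounds s))))

  level-surjective : ∀ k → k ≤ ∣ B α ∣ → ∃ λ q → BSide α q × level q ≡ k
  level-surjective k k≤ with m≤n⇒m<n∨m≡n k≤
  ... | inj₂ refl = b α , inj₂ refl , level-b
  ... | inj₁ k<   with count<-surjective (B α) k k<
  ...   | q , q∈B , eq = q , inj₁ q∈B , trans (level≡count< q) eq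

  ASide-before-BSide : ∀ {i q} → ASide α i → BSide α q → level i ≤ level q → toℕ i < toℕ q
  ASide-before-BSide {i} {q} s t li≤lq with <-cmp (toℕ i) (toℕ q)
  ... | tri< i<q _ _ = i<q
  ... | tri≈ _ i≡q _ = ⊥-elim (ASide⇒¬BSide s (subst (BSide α) (sym (toℕ-injective i≡q)) t))
  ... | tri> _ _ q<i = ⊥-elim (<⇒≱ (level-strict t q<i (<⇒≤ (proj₂ (ASide-bounds s)))) li≤lq)

  BSide-before-ASide : ∀ {i q} → ASide α i → BSide α q → toℕ q < toℕ i → level q < level i
  BSide-before-ASide s t q<i = level-strict t q<i (<⇒≤ (proj₂ (ASide-bounds s)))

  ends-ASide : ∀ {i} → ASide α i → ends α i ≡ (level i , top α)
  ends-ASide {i} s with i F.<? a α | b α F.<? i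
  ... | yes i<a | _   = ⊥-elim (<⇒≱ i<a (proj₁ (ASide-bounds s)))
  ... | no _    | yes b<i = ⊥-elim (<⇒≱ b<i (<⇒≤ (proj₂ (ASide-bounds s))))
  ... | no _    | no _ with i F.≟ a α | i F.≟ b α | lookup (B α) i in i∈B
  ...   | yes _ | _       | _     = refl
  ...   | no _  | yes i≡b | _     = ⊥-elim (ASide⇒¬BSide s (inj₂ i≡b))
  ...   | no _  | no _    | true  = ⊥-elim (ASide⇒¬BSide s (inj₁ (lookup⇒[]= i (B α) i∈B)))
  ...   | no _  | no _    | false = refl

  ends-BSide : ∀ {i} → BSide α i → ends α i ≡ (level i , suc (level i))
  ends-BSide {i} t with i F.<? a α | b α F.<? i
  ... | yes i<a | _       = ⊥-elim (<⇒≱ i<a (<⇒≤ (proj₁ (BSide-bounds t))))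
  ... | no _    | yes b<i = ⊥-elim (<⇒≱ b<i (proj₂ (BSide-bounds t)))
  ... | no _    | no _ with i F.≟ a α | i F.≟ b α | lookup (B α) i in i∈B
  ...   | yes i≡a | _       | _     = ⊥-elim (ASide⇒¬BSide (inj₁ i≡a) t)
  ...   | no _    | yes _   | _     = refl
  ...   | no _    | no _    | true  = refl
  ...   | no _    | no i≢b  | false with t
  ...     | inj₁ i∈B′ = ⊥-elim (true≢false (trans (sym ([]=⇒lookup i∈B′)) i∈B))
  ...     | inj₂ i≡b  = ⊥-elim (i≢b i≡b)

  Outside : Fin n → Set
  Outside i = toℕ i < toℕ (a α) ⊎ toℕ (b α) < toℕ i

  ends-Outside : ∀ {i} → Outside i → ends α i ≡ (top α , top α)
  ends-Outside {i} out with i F.<? a α | b α F.<? i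
  ... | yes _ | _     = refl
  ... | no _  | yes _ = refl
  ... | no i≮a | no b≮i with out
  ...   | inj₁ i<a = ⊥-elim (i≮a i<a)
  ...   | inj₂ b<i = ⊥-elim (b≮i b<i)

  data Label (i : Fin n) : Set where
    outside : Outside i → Label i
    a-side  : ASide α i → Label i
    b-side  : BSide α i → Label i

  label : ∀ i → Label i
  label i with toℕ i <? toℕ (a α) | toℕ (b α) <? toℕ i
  ... | yes i<a | _       = outside (inj₁ i<a)
  ... | no _    | yes b<i = outside (inj₂ b<i)
  ... | no i≮a  | no b≮i with ASide⊎BSide i (≮⇒≥ i≮a) (≮⇒≥ b≮i)
  ...   | inj₁ s = a-side s
  ...   | inj₂ t = b-side t

  ∈BbSet⇒BSide : ∀ {j} → j ∈ BbSet α → BSide α j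
  ∈BbSet⇒BSide {j} j∈ with lookup (B α) j in j∈B | toℕ j ℕ.≡ᵇ toℕ (b α) in j≡b
                           | trans (sym (lookup∘tabulate _ j)) ([]=⇒lookup j∈)
  ... | true  | _     | _ = inj₁ (lookup⇒[]= j (B α) j∈B)
  ... | false | true  | _ = inj₂ (toℕ-injective (≡ᵇ⇒≡ _ _ (from T-≡ j≡b)))
  ... | false | false | ()

  BSide⇒∈BbSet : ∀ {j} → BSide α j → j ∈ BbSet α
  BSide⇒∈BbSet {j} t = lookup⇒[]= j (BbSet α) (trans (lookup∘tabulate _ j) (marked t))
    where
    marked : BSide α j → (Bool.if lookup (B α) j then true else
                           (Bool.if toℕ j ℕ.≡ᵇ toℕ (b α) then true else false)) ≡ true
    marked (inj₁ j∈B) rewrite []=⇒lookup j∈B = refl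
    marked (inj₂ refl) with lookup (B α) j
    ... | true  = refl
    ... | false rewrite to T-≡ (≡⇒≡ᵇ (toℕ j) (toℕ j) refl) = refl

  Conn-trans : ∀ {Y u v w} → Conn α Y u v → Conn α Y v w → Conn α Y u w
  Conn-trans here            q = q
  Conn-trans (fwd i i∈Y p)   q = fwd i i∈Y (Conn-trans p q)
  Conn-trans (bwd i i∈Y p)   q = bwd i i∈Y (Conn-trans p q)

  Conn-sym : ∀ {Y u v} → Conn α Y u v → Conn α Y v u
  Conn-sym here          = here
  Conn-sym (fwd i i∈Y p) = Conn-trans (Conn-sym p) (bwd i i∈Y here)
  Conn-sym (bwd i i∈Y p) = Conn-trans (Conn-sym p) (fwd i i∈Y here)

  Conn-ASide : ∀ {Y i w} → i ∈ Y → ASide α i → Conn α Y (top α) w → Conn α Y (level i) w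
  Conn-ASide {Y} {i} {w} i∈Y s p =
    subst (λ e → Conn α Y (proj₁ e) w) (ends-ASide s)
          (fwd i i∈Y (subst (λ e → Conn α Y (proj₂ e) w) (sym (ends-ASide s)) p))

  Conn-BSide : ∀ {Y i w} → i ∈ Y → BSide α i → Conn α Y (suc (level i)) w → Conn α Y (level i) w
  Conn-BSide {Y} {i} {w} i∈Y t p =
    subst (λ e → Conn α Y (proj₁ e) w) (ends-BSide t)
          (fwd i i∈Y (subst (λ e → Conn α Y (proj₂ e) w) (sym (ends-BSide t)) p))

  Respects : (ℕ → Set) → Subset n → Set
  Respects P Y = (∀ {i} → i ∈ Y → ASide α i → P (level i) ⇔ P (top α))
               × (∀ {i} → i ∈ Y → BSide α i → P (level i) ⇔ P (suc (level i)))

  Conn-preserves : ∀ (P : ℕ → Set) {Y u w} → Respects P Y → Conn α Y u w → P u → P w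
  Conn-preserves P {Y} resp = go
    where
    edge : ∀ {i} → i ∈ Y → P (proj₁ (ends α i)) ⇔ P (proj₂ (ends α i))
    edge {i} i∈Y with label i
    ... | outside out rewrite ends-Outside out = mk⇔ id id
    ... | a-side s    rewrite ends-ASide s     = proj₁ resp i∈Y s
    ... | b-side t    rewrite ends-BSide t     = proj₂ resp i∈Y t
    go : ∀ {u w} → Conn α Y u w → P u → P w
    go here          Pu = Pu
    go (fwd i i∈Y p) Pu = go p (to   (edge i∈Y) Pu)
    go (bwd i i∈Y p) Pu = go p (from (edge i∈Y) Pu)

  B-path : ∀ Y {u} w → u ≤ w → w ≤ top α →
           (∀ q → BSide α q → u ≤ level q → level q < w → q ∈ Y) → Conn α Y u w
  B-path Y zero    z≤n _ _ = here
  B-path Y {u} (suc w) u≤ w< B⊆Y with m≤n⇒m<n∨m≡n u≤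
  ... | inj₂ refl = here
  ... | inj₁ (s≤s u≤w) with level-surjective w (s≤s⁻¹ w<)
  ...   | q , t , refl = Conn-trans (B-path Y w u≤w (≤-trans (n≤1+n w) w<) B⊆Y′)
                                    (Conn-BSide (B⊆Y q t u≤w ≤-refl) t here)
    where B⊆Y′ : ∀ q′ → BSide α q′ → u ≤ level q′ → level q′ < level q → q′ ∈ Y
          B⊆Y′ q′ t′ u≤q′ q′<w = B⊆Y q′ t′ u≤q′ (≤-trans q′<w (n≤1+n w))

  module _ (X : Subset n) where

    Opener : Fin n → Set
    Opener i = ASide α i × i ∈ X

    Closer : Fin n → Set
    Closer q = BSide α q × q ∉ X

    Opener? : Decidable Opener
    Opener? i = ASide? i ×-dec (i ∈? X)

    Closer? : Decidable Closer
    Closer? q = BSide? q ×-dec ¬? (q ∈? X)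

    record Alternating : Set where
      field
        sides          : ∀ {i} → i ∈ X → ASide α i ⊎ BSide α i
        closer-between : ∀ {i i′} → Opener i → Opener i′ → toℕ i < toℕ i′ →
                         ∃ λ q → Closer q × toℕ i < toℕ q × toℕ q < toℕ i′
        closer-after   : ∀ {i} → Opener i → ∃ λ q → Closer q × toℕ i < toℕ q
        opener-before  : ∀ {q} → Closer q → ∃ λ i → Opener i × toℕ i < toℕ q ×
                         (∀ q′ → Closer q′ → toℕ i < toℕ q′ → toℕ q′ < toℕ q → ⊥)

    Closer-level≢ : ∀ {q k} → Closer q → BSide α k → k ∈ X → level q ≢ level k
    Closer-level≢ (t , q∉X) t′ k∈X eq = q∉X (subst (_∈ X) (sym (level-injective t t′ eq)) k∈X)

    ClearUpTo : ℕ → ℕ → Set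
    ClearUpTo v u = u ≤ v × (∀ q → Closer q → u ≤ level q → level q < v → ⊥)

    ClearUpTo-BSide : ∀ {v k} → k ∈ X → BSide α k → level k ≢ v →
                      ClearUpTo v (level k) ⇔ ClearUpTo v (suc (level k))
    ClearUpTo-BSide {v} {k} k∈X t k≢v = mk⇔ up down
      where
      up : ClearUpTo v (level k) → ClearUpTo v (suc (level k))
      up (k≤v , clear) = ≤∧≢⇒< k≤v k≢v , λ q c l u → clear q c (≤-trans (n≤1+n _) l) u
      down : ClearUpTo v (suc (level k)) → ClearUpTo v (level k)
      down (k<v , clear) = ≤-trans (n≤1+n _) k<v , clear′
        where
        clear′ : ∀ q → Closer q → level k ≤ level q → level q < v → ⊥
        clear′ q c l u with level q ≟ level k
        ... | yes e = Closer-level≢ c t k∈X e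
        ... | no ne = clear q c (≤∧≢⇒< l (ne ∘ sym)) u

    ClearUpTo? : ∀ v u → Dec (ClearUpTo v u)
    ClearUpTo? v u with u ≤? v | any? (λ q → Closer? q ×-dec (u ≤? level q) ×-dec (level q <? v))
    ... | no u≰v | _                   = no (u≰v ∘ proj₁)
    ... | yes _  | yes (q , c , l , h) = no λ cl → proj₂ cl q c l h
    ... | yes u≤v | no none            = yes (u≤v , λ q c l h → none (q , c , l , h))

  -- Spanning trees are alternating

  module _ {X : Subset n} (tree : IsSpanningTree α X) where
    private
      bridge : ∀ {i} → i ∈ X → ¬ Conn α (X - i) (proj₁ (ends α i)) (proj₂ (ends α i))
      bridge = proj₂ tree _

      Opener-bridge : ∀ {i} → Opener X i → ¬ Conn α (X - i) (level i) (top α)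
      Opener-bridge {i} (s , i∈X) p =
        bridge i∈X (subst (λ e → Conn α (X - i) (proj₁ e) (proj₂ e)) (sym (ends-ASide s)) p)

      ∈X-i : ∀ {q i} → q ∈ X → BSide α q → ASide α i → q ∈ X - i
      ∈X-i q∈X t s = x∈p∧x≢y⇒x∈p-y q∈X λ { refl → ASide⇒¬BSide s t }

      tree-sides : ∀ {i} → i ∈ X → ASide α i ⊎ BSide α i
      tree-sides {i} i∈X with label i
      ... | outside out = ⊥-elim (bridge i∈X (subst (λ e → Conn α (X - i) (proj₁ e) (proj₂ e))
                                                    (sym (ends-Outside out)) here))
      ... | a-side s = inj₁ s
      ... | b-side t = inj₂ t

      -- Without a closer in between, the b-edges of X join level i to level i′, so i′ is no bridge.
      tree-closer-between : ∀ {i i′} → Opener X i → Opener X i′ → toℕ i < toℕ i′ →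
                            ∃ λ q → Closer X q × toℕ i < toℕ q × toℕ q < toℕ i′
      tree-closer-between {i} {i′} oi@(s , i∈X) oi′@(s′ , _) i<i′
        with any? (λ q → Closer? X q ×-dec (toℕ i <? toℕ q) ×-dec (toℕ q <? toℕ i′))
      ... | yes found = found
      ... | no none = ⊥-elim (Opener-bridge oi′ (Conn-trans (Conn-sym between) i-top))
        where
        B⊆ : ∀ q → BSide α q → level i ≤ level q → level q < level i′ → q ∈ X - i′
        B⊆ q t lq≥ lq< with q ∈? X
        ... | yes q∈X = ∈X-i q∈X t s′
        ... | no q∉X  = ⊥-elim (none (q , (t , q∉X) , ASide-before-BSide s t lq≥ , level<⇒< lq<))
        between : Conn α (X - i′) (level i) (level i′)
        between = B-path (X - i′) (level i′) (level-mono (<⇒≤ i<i′)) (<⇒≤ (level<top i′)) B⊆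
        i-top : Conn α (X - i′) (level i) (top α)
        i-top = Conn-ASide (x∈p∧x≢y⇒x∈p-y i∈X λ { refl → <-irrefl refl i<i′ }) s here

      tree-closer-after : ∀ {i} → Opener X i → ∃ λ q → Closer X q × toℕ i < toℕ q
      tree-closer-after {i} oi@(s , _) with any? (λ q → Closer? X q ×-dec (toℕ i <? toℕ q))
      ... | yes found = found
      ... | no none = ⊥-elim (Opener-bridge oi (B-path (X - i) (top α) (<⇒≤ (level<top i)) ≤-refl B⊆))
        where
        B⊆ : ∀ q → BSide α q → level i ≤ level q → level q < top α → q ∈ X - i
        B⊆ q t lq≥ _ with q ∈? X
        ... | yes q∈X = ∈X-i q∈X t s
        ... | no q∉X  = ⊥-elim (none (q , (t , q∉X) , ASide-before-BSide s t lq≥))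

      -- If every opener before q were followed by a closer before q, the levels up to level q that
      -- are clear of closers would be closed under the edges of X, yet X joins level q to the top.
      tree-opener-before : ∀ {q} → Closer X q → ∃ λ i → Opener X i × toℕ i < toℕ q ×
                           (∀ q′ → Closer X q′ → toℕ i < toℕ q′ → toℕ q′ < toℕ q → ⊥)
      tree-opener-before {q} cq@(t , _)
        with any? (λ i → Opener? X i ×-dec (toℕ i <? toℕ q) ×-dec
                         ¬? (any? (λ q′ → Closer? X q′ ×-dec (toℕ i <? toℕ q′) ×-dec (toℕ q′ <? toℕ q))))
      ... | yes (i , oi , i<q , no-closer) = i , oi , i<q , λ q′ c′ l u → no-closer (q′ , c′ , l , u)
      ... | no none = ⊥-elim (<⇒≱ (level<top q) (proj₁ top-clear))
        where
        q-top : Conn α X (level q) (top α)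
        q-top = Conn-trans (Conn-sym (proj₁ tree (level q) (<⇒≤ (level<top q)))) (proj₁ tree (top α) ≤-refl)
        opener-unclear : ∀ {k} → k ∈ X → ASide α k → ¬ ClearUpTo X (level q) (level k)
        opener-unclear {k} k∈X s (lk≤ , clear) =
          none (k , (s , k∈X) , ASide-before-BSide s t lk≤ ,
                λ { (q′ , c′ , l , u) → clear q′ c′ (level-mono (<⇒≤ l))
                                              (level-strict (proj₁ c′) u (proj₂ (BSide-bounds t))) })
        clear-respected : Respects (ClearUpTo X (level q)) X
        clear-respected = (λ k∈X s → mk⇔ (⊥-elim ∘ opener-unclear k∈X s)
                                         (λ c → ⊥-elim (<⇒≱ (level<top q) (proj₁ c))))
                        , (λ k∈X t′ → ClearUpTo-BSide X k∈X t′ (λ e → Closer-level≢ X cq t′ k∈X (sym e)))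
        top-clear : ClearUpTo X (level q) (top α)
        top-clear = Conn-preserves (ClearUpTo X (level q)) clear-respected q-top (≤-refl , λ _ _ l u → <⇒≱ u l)

    spanningTree⇒Alternating : Alternating X
    spanningTree⇒Alternating = record
      { sides = tree-sides ; closer-between = tree-closer-between
      ; closer-after = tree-closer-after ; opener-before = tree-opener-before }

  -- Alternating sets are spanning trees

  module _ {X : Subset n} (alt : Alternating X) where
    open Alternating alt

    private
      Gap : ℕ → ℕ → ℕ → Set
      Gap u w k = (u ≤ k × k < w) ⊎ (w ≤ k × k < u)

      Gap-suc : ∀ {u w k} → k ≢ u → Gap u w k → Gap (suc u) w k
      Gap-suc k≢u (inj₁ (u≤k , k<w)) = inj₁ (≤∧≢⇒< u≤k (k≢u ∘ sym) , k<w)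
      Gap-suc k≢u (inj₂ (w≤k , k<u)) = inj₂ (w≤k , ≤-trans k<u (n≤1+n _))

      Gap-suc⁻ : ∀ {u w k} → k ≢ u → Gap (suc u) w k → Gap u w k
      Gap-suc⁻ k≢u (inj₁ (u<k , k<w)) = inj₁ (≤-trans (n≤1+n _) u<k , k<w)
      Gap-suc⁻ k≢u (inj₂ (w≤k , k<su)) = inj₂ (w≤k , ≤∧≢⇒< (s≤s⁻¹ k<su) k≢u)

      Gap-empty : ∀ {w k} → ¬ Gap w w k
      Gap-empty (inj₁ (l , u)) = <⇒≱ u l
      Gap-empty (inj₂ (l , u)) = <⇒≱ u l

      Opener-bridge : ∀ {i} → Opener X i → ¬ Conn α (X - i) (level i) (top α)
      Opener-bridge {i} oi@(s , _) p =
        <-irrefl refl (proj₁ (Conn-preserves Sealed sealed-respected p (level<top i , λ _ _ → Gap-empty)))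
        where
        -- No edge of X − i crosses a closer level, and closer-after and closer-between put a
        -- closer level between level i and the top and between level i and any other opener.
        Sealed : ℕ → Set
        Sealed u = u < top α × (∀ q → Closer X q → Gap u (level i) (level q) → ⊥)
        opener-unsealed : ∀ {k} → k ∈ X - i → ASide α k → ¬ Sealed (level k)
        opener-unsealed {k} k∈ s′ (_ , sealed) with <-cmp (toℕ k) (toℕ i)
        ... | tri≈ _ k≡i _ = x∈p-y⇒x≢y X k∈ (toℕ-injective k≡i)
        ... | tri< k<i _ _ with closer-between (s′ , x∈p-y⇒x∈p X k∈) oi k<i
        ...   | q , c , k<q , q<i = sealed q c (inj₁ (level-mono (<⇒≤ k<q) , BSide-before-ASide s (proj₁ c) q<i))
        opener-unsealed {k} k∈ s′ (_ , sealed) | tri> _ _ i<k with closer-between oi (s′ , x∈p-y⇒x∈p X k∈) i<k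
        ...   | q , c , i<q , q<k = sealed q c (inj₂ (level-mono (<⇒≤ i<q) , BSide-before-ASide s′ (proj₁ c) q<k))
        B-step : ∀ {k} → k ∈ X - i → BSide α k → Sealed (level k) ⇔ Sealed (suc (level k))
        B-step {k} k∈ t = mk⇔ up down
          where
          k∈X = x∈p-y⇒x∈p X k∈
          up : Sealed (level k) → Sealed (suc (level k))
          up (_ , sealed) with suc (level k) <? top α
          ... | yes k<top = k<top , λ q c gap → sealed q c (Gap-suc⁻ (Closer-level≢ X c t k∈X) gap)
          ... | no k≮top with closer-after oi
          ...   | q , c , i<q = ⊥-elim (sealed q c (inj₂ (level-mono (<⇒≤ i<q) , q<k)))
            where
            q<k : level q < level k
            q<k = ≤∧≢⇒< (≤-trans (level≤∣B∣ q) (≮⇒≥ (k≮top ∘ s≤s))) (Closer-level≢ X c t k∈X)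
          down : Sealed (suc (level k)) → Sealed (level k)
          down (_ , sealed) = level<top k , λ q c gap → sealed q c (Gap-suc (Closer-level≢ X c t k∈X) gap)
        sealed-respected : Respects Sealed (X - i)
        sealed-respected = (λ k∈ s′ → mk⇔ (⊥-elim ∘ opener-unsealed k∈ s′)
                                          (λ st → ⊥-elim (<-irrefl refl (proj₁ st))))
                         , B-step

      BSide-bridge-no-opener : ∀ {j} → j ∈ X → BSide α j →
                               (∀ i → Opener X i → ¬ ClearUpTo X (level j) (level i)) →
                               ¬ Conn α (X - j) (level j) (suc (level j))
      BSide-bridge-no-opener {j} j∈X t no-opener p =
        <-irrefl refl (proj₁ (Conn-preserves (ClearUpTo X (level j)) clear-respected p (≤-refl , λ _ _ l u → <⇒≱ u l)))
        where
        clear-respected : Respects (ClearUpTo X (level j)) (X - j)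
        clear-respected =
            (λ k∈ s → mk⇔ (⊥-elim ∘ no-opener _ (s , x∈p-y⇒x∈p X k∈))
                          (λ c → ⊥-elim (<⇒≱ (level<top j) (proj₁ c))))
          , (λ k∈ t′ → ClearUpTo-BSide X (x∈p-y⇒x∈p X k∈) t′ (x∈p-y⇒x≢y X k∈ ∘ level-injective t′ t))

      BSide-bridge-opener : ∀ {i j} → j ∈ X → BSide α j → Opener X i → ClearUpTo X (level j) (level i) →
                            ¬ Conn α (X - j) (level j) (suc (level j))
      BSide-bridge-opener {i} {j} j∈X t oi (li≤lj , clear) p =
        <-irrefl refl (proj₁ (Conn-preserves ClearAbove clear-respected (Conn-sym p)
                                             (≤-refl , λ _ _ l u → <⇒≱ l (s≤s⁻¹ u))))
        where
        ClearAbove : ℕ → Set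
        ClearAbove u = level j < u × (∀ q → Closer X q → level j < level q → level q < u → ⊥)
        closer-obstructs : ∀ {u q} → ClearAbove u → Closer X q → toℕ i < toℕ q → level q < u → ⊥
        closer-obstructs (_ , above) c i<q q<u with <-cmp (level _) (level j)
        ... | tri< q<j _ _ = clear _ c (level-mono (<⇒≤ i<q)) q<j
        ... | tri≈ _ q≡j _ = Closer-level≢ X c t j∈X q≡j
        ... | tri> _ _ j<q = above _ c j<q q<u
        top-unclear : ¬ ClearAbove (top α)
        top-unclear ca with closer-after oi
        ... | q , c , i<q = closer-obstructs ca c i<q (level<top q)
        opener-unclear : ∀ {k} → k ∈ X - j → ASide α k → ¬ ClearAbove (level k)
        opener-unclear {k} k∈ s ca@(j<k , _)
          with closer-between oi (s , x∈p-y⇒x∈p X k∈) (level<⇒< (≤-<-trans li≤lj j<k))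
        ... | q , c , i<q , q<k = closer-obstructs ca c i<q (BSide-before-ASide s (proj₁ c) q<k)
        B-step : ∀ {k} → k ∈ X - j → BSide α k → ClearAbove (level k) ⇔ ClearAbove (suc (level k))
        B-step {k} k∈ t′ = mk⇔ up down
          where
          k∈X = x∈p-y⇒x∈p X k∈
          up : ClearAbove (level k) → ClearAbove (suc (level k))
          up (j<k , above) = ≤-trans j<k (n≤1+n _) , above′
            where
            above′ : ∀ q → Closer X q → level j < level q → level q < suc (level k) → ⊥
            above′ q c l u with level q ≟ level k
            ... | yes e = Closer-level≢ X c t′ k∈X e
            ... | no ne = above q c l (≤∧≢⇒< (s≤s⁻¹ u) ne)
          down : ClearAbove (suc (level k)) → ClearAbove (level k)
          down (j<sk , above) = ≤∧≢⇒< (s≤s⁻¹ j<sk) (x∈p-y⇒x≢y X k∈ ∘ level-injective t′ t ∘ sym)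
                              , λ q c l u → above q c l (≤-trans u (n≤1+n _))
        clear-respected : Respects ClearAbove (X - j)
        clear-respected = (λ k∈ s → mk⇔ (⊥-elim ∘ opener-unclear k∈ s) (⊥-elim ∘ top-unclear)) , B-step

      -- Without j, levels j and j + 1 can only be joined through the top, i.e. through an opener.
      -- If no opener is reachable down from level j without crossing a closer, that side is stuck;
      -- otherwise the closers after such an opener cut level j + 1 off from the top and all later openers.
      BSide-bridge : ∀ {j} → j ∈ X → BSide α j → ¬ Conn α (X - j) (level j) (suc (level j))
      BSide-bridge {j} j∈X t with any? (λ i → Opener? X i ×-dec ClearUpTo? X (level j) (level i))
      ... | yes (i , oi , clear) = BSide-bridge-opener j∈X t oi clear
      ... | no none              = BSide-bridge-no-opener j∈X t λ i oi clear → none (i , oi , clear)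

      -- The b-label at level v is in X or is a closer, whose opener reaches level v along b-edges of X.
      climb : ∀ v → v ≤ ∣ B α ∣ → Conn α X (suc v) (top α) → Conn α X v (top α)
      climb v v≤ p with level-surjective v v≤
      ... | q , t , refl with q ∈? X
      ...   | yes q∈X = Conn-BSide q∈X t p
      ...   | no q∉X with opener-before (t , q∉X)
      ...     | i , (s , i∈X) , i<q , no-closer = Conn-trans (Conn-sym i-q) (Conn-ASide i∈X s here)
        where
        B⊆X : ∀ q′ → BSide α q′ → level i ≤ level q′ → level q′ < level q → q′ ∈ X
        B⊆X q′ t′ l u with q′ ∈? X
        ... | yes q′∈X = q′∈X
        ... | no q′∉X  = ⊥-elim (no-closer q′ (t′ , q′∉X) (ASide-before-BSide s t′ l) (level<⇒< u))
        i-q : Conn α X (level i) (level q)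
        i-q = B-path X (level q) (level-mono (<⇒≤ i<q)) (≤-trans v≤ (n≤1+n _)) B⊆X

      reach-top : ∀ v → v ≤ top α → Conn α X v (top α)
      reach-top v v≤ = go (top α ∸ v) v (m∸n+n≡m v≤)
        where
        go : ∀ d v → d + v ≡ top α → Conn α X v (top α)
        go zero    v refl = here
        go (suc d) v eq   = climb v (subst (v ≤_) (suc-injective eq) (m≤n+m v d))
                                    (go d (suc v) (trans (+-suc d v) eq))

    Alternating⇒spanningTree : IsSpanningTree α X
    Alternating⇒spanningTree = connected , acyclic
      where
      connected : ∀ v → v ≤ top α → Conn α X 0 v
      connected v v≤ = Conn-trans (reach-top 0 z≤n) (Conn-sym (reach-top v v≤))
      acyclic : ∀ i → i ∈ X → ¬ Conn α (X - i) (proj₁ (ends α i)) (proj₂ (ends α i))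
      acyclic i i∈X with sides i∈X
      ... | inj₁ s rewrite ends-ASide s = Opener-bridge (s , i∈X)
      ... | inj₂ t rewrite ends-BSide t = BSide-bridge i∈X t

  -- Alternating sets and alternating matchings

  χ-below : ∀ {lo ps} → AltFrom α lo ps → ∀ j → toℕ j < lo → χ ps j ≡ 0ℚ
  χ-below [] j _ = refl
  χ-below {ps = (x , y) ∷ ps} ((lo≤x , _ , x<y , _) ∷ rest) j j<lo = begin
      (e x j Q.- e y j) Q.+ χ ps j ≡⟨ cong₂ (λ u v → (u Q.- v) Q.+ χ ps j) (e-off (≢-sym (<⇒≢ᶠ j<x)))
                                                                         (e-off (≢-sym (<⇒≢ᶠ j<y))) ⟩
      (0ℚ Q.- 0ℚ) Q.+ χ ps j       ≡⟨ cong ((0ℚ Q.- 0ℚ) Q.+_) (χ-below rest j (<-trans j<y (n<1+n _))) ⟩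
      0ℚ                           ∎
    where
    open ≡-Reasoning
    j<x = <-≤-trans j<lo lo≤x
    j<y = <-trans j<x x<y

  module _ {X : Subset n} (alt : Alternating X) where
    open Alternating alt

    Represents : ℕ → List (Fin n × Fin n) → Set
    Represents lo ps = ∀ j → lo ≤ toℕ j → 𝟏 X j ≡ χ ps j Q.+ 𝟏 (BbSet α) j

    Balanced : ℕ → Set
    Balanced lo = ∀ {i} → Opener X i → toℕ i < lo → ∃ λ q → Closer X q × toℕ i < toℕ q × toℕ q < lo

    record FirstPair (lo : ℕ) (i q : Fin n) : Set where
      field
        lo≤i        : lo ≤ toℕ i
        opener      : Opener X i
        first-opener : ∀ j → lo ≤ toℕ j → toℕ j < toℕ i → ¬ Opener X j
        i<q         : toℕ i < toℕ q
        closer      : Closer X q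
        first-closer : ∀ j → suc (toℕ i) ≤ toℕ j → toℕ j < toℕ q → ¬ Closer X j

    ¬Opener∧¬Closer⇒𝟏≡ : ∀ {j} → ¬ Opener X j → ¬ Closer X j → 𝟏 X j ≡ 𝟏 (BbSet α) j
    ¬Opener∧¬Closer⇒𝟏≡ {j} ¬o ¬c with j ∈? X
    ... | yes j∈X with sides j∈X
    ...   | inj₁ s = ⊥-elim (¬o (s , j∈X))
    ...   | inj₂ t = trans (𝟏-∈ j∈X) (sym (𝟏-∈ (BSide⇒∈BbSet t)))
    ¬Opener∧¬Closer⇒𝟏≡ {j} ¬o ¬c | no j∉X with BSide? j
    ...   | yes t = ⊥-elim (¬c (t , j∉X))
    ...   | no ¬t = trans (𝟏-∉ j∉X) (sym (𝟏-∉ (¬t ∘ ∈BbSet⇒BSide)))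

    no-closer-without-opener : ∀ {lo t} → Balanced lo → (∀ j → lo ≤ toℕ j → toℕ j < t → ¬ Opener X j) →
                               ∀ j → lo ≤ toℕ j → toℕ j < t → ¬ Closer X j
    no-closer-without-opener {lo} bal no-opener j lo≤j j<t c with opener-before c
    ... | i , o , i<j , no-closer with toℕ i <? lo
    ...   | yes i<lo = let (q , c′ , i<q , q<lo) = bal o i<lo in no-closer q c′ i<q (<-≤-trans q<lo lo≤j)
    ...   | no i≮lo  = no-opener i (≮⇒≥ i≮lo) (<-trans i<j j<t) o

    first-pair : ∀ {lo} → (∀ j → lo ≤ toℕ j → ¬ Opener X j) ⊎ ∃ λ i → ∃ λ q → FirstPair lo i q
    first-pair {lo} with first-from (Opener? X) lo
    ... | inj₁ none = inj₁ none
    ... | inj₂ (i , lo≤i , o , first-o) with first-from (Closer? X) (suc (toℕ i))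
    ...   | inj₁ none = ⊥-elim (let (q , c , i<q) = closer-after o in none q i<q c)
    ...   | inj₂ (q , i<q , c , first-c) =
            inj₂ (i , q , record { lo≤i = lo≤i ; opener = o ; first-opener = first-o
                                 ; i<q = i<q ; closer = c ; first-closer = first-c })

    module _ {lo i q} (bal : Balanced lo) (fp : FirstPair lo i q) where
      open FirstPair fp

      FirstPair-balanced : Balanced (suc (toℕ q))
      FirstPair-balanced {i′} o′ i′<sq with toℕ i′ <? lo
      ... | yes i′<lo = let (q′ , c′ , l , u) = bal o′ i′<lo
                        in q′ , c′ , l , ≤-trans u (≤-trans lo≤i (<⇒≤ (<-trans i<q (n<1+n _))))
      ... | no i′≮lo with <-cmp (toℕ i′) (toℕ i)
      ...   | tri< i′<i _ _ = ⊥-elim (first-opener i′ (≮⇒≥ i′≮lo) i′<i o′)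
      ...   | tri≈ _ i′≡i _ = q , closer , subst (_< toℕ q) (sym i′≡i) i<q , n<1+n _
      ...   | tri> _ _ i<i′ = let (q′ , c′ , l , u) = closer-between opener o′ i<i′
                              in ⊥-elim (first-closer q′ l (<-≤-trans u (s≤s⁻¹ i′<sq)) c′)

      FirstPair-quiet : ∀ {j} → lo ≤ toℕ j → toℕ j < toℕ q → j ≢ i → ¬ Opener X j × ¬ Closer X j
      FirstPair-quiet {j} lo≤j j<q j≢i with <-cmp (toℕ j) (toℕ i)
      ... | tri< j<i _ _ = first-opener j lo≤j j<i
                         , no-closer-without-opener bal first-opener j lo≤j j<i
      ... | tri≈ _ j≡i _ = ⊥-elim (j≢i (toℕ-injective j≡i))
      ... | tri> _ _ i<j = (λ o → let (q′ , c′ , l , u) = closer-between opener o i<j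
                                  in first-closer q′ l (<-trans u j<q) c′)
                         , first-closer j i<j j<q

      FirstPair-represents : ∀ {ps} → AltFrom α (suc (toℕ q)) ps → Represents (suc (toℕ q)) ps →
                             Represents lo ((i , q) ∷ ps)
      FirstPair-represents {ps} rest rep j lo≤j with j F.≟ i | j F.≟ q
      ... | yes refl | _
        rewrite e-diag j | e-off (≢-sym (<⇒≢ᶠ i<q)) | χ-below rest j (<-trans i<q (n<1+n _))
              | 𝟏-∈ (proj₂ opener) | 𝟏-∉ (ASide⇒¬BSide (proj₁ opener) ∘ ∈BbSet⇒BSide) = refl
      ... | no _ | yes refl
        rewrite e-diag j | e-off (<⇒≢ᶠ i<q) | χ-below rest j (n<1+n _)
              | 𝟏-∉ (proj₂ closer) | 𝟏-∈ (BSide⇒∈BbSet (proj₁ closer)) = refl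
      ... | no j≢i | no j≢q
        rewrite e-off (j≢i ∘ sym) | e-off (j≢q ∘ sym) with toℕ j <? suc (toℕ q)
      ...   | no j≮sq = trans (rep j (≮⇒≥ j≮sq)) (cong (Q._+ 𝟏 (BbSet α) j) (sym (QP.+-identityˡ (χ ps j))))
      ...   | yes j<sq rewrite χ-below rest j j<sq =
              let (¬o , ¬c) = FirstPair-quiet lo≤j (≤∧≢⇒< (s≤s⁻¹ j<sq) (j≢q ∘ toℕ-injective)) j≢i
              in trans (¬Opener∧¬Closer⇒𝟏≡ ¬o ¬c) (sym (QP.+-identityˡ _))

    -- Peel off the first opener from lo on and the first closer after it; k is fuel.
    matching-from : ∀ k lo → n ≤ lo + k → Balanced lo →
                    Σ (List (Fin n × Fin n)) λ ps → AltFrom α lo ps × Represents lo ps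
    matching-from zero lo n≤ _ =
      [] , [] , λ j lo≤j → ⊥-elim (<⇒≱ (toℕ<n j) (≤-trans (subst (n ≤_) (+-identityʳ lo) n≤) lo≤j))
    matching-from (suc k) lo n≤ bal with first-pair {lo}
    ... | inj₁ none = [] , [] , λ j lo≤j →
          trans (¬Opener∧¬Closer⇒𝟏≡ (none j lo≤j)
                                     (no-closer-without-opener bal (λ j′ l _ → none j′ l) j lo≤j (toℕ<n j)))
                (sym (QP.+-identityˡ _))
    ... | inj₂ (i , q , fp) =
          (i , q) ∷ ps , (lo≤i , proj₁ (ASide-bounds (proj₁ opener)) , i<q , proj₂ (BSide-bounds (proj₁ closer))
                         , proj₁ opener , proj₁ closer) ∷ rest
          , FirstPair-represents bal fp rest rep
      where
      open FirstPair fp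
      n≤′ : n ≤ suc (toℕ q) + k
      n≤′ = ≤-trans n≤ (≤-trans (≤-reflexive (+-suc lo k)) (s≤s (+-monoˡ-≤ k (≤-trans lo≤i (<⇒≤ i<q)))))
      next = matching-from k (suc (toℕ q)) n≤′ (FirstPair-balanced bal fp)
      ps = proj₁ next
      rest = proj₁ (proj₂ next)
      rep = proj₂ (proj₂ next)

    Alternating⇒matching : Σ (List (Fin n × Fin n)) λ ps → IsAltMatching α ps ×
                           (∀ j → 𝟏 X j ≡ χ ps j Q.+ 𝟏 (BbSet α) j)
    Alternating⇒matching with matching-from n 0 ≤-refl (λ _ ())
    ... | ps , alt-ps , rep = ps , alt-ps , λ j → rep j z≤n

  Opens : Fin n → List (Fin n × Fin n) → Set
  Opens j = Any (λ p → proj₁ p ≡ j)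

  Closes : Fin n → List (Fin n × Fin n) → Set
  Closes j = Any (λ p → proj₂ p ≡ j)

  Opens? : ∀ j ps → Dec (Opens j ps)
  Opens? j = Any.any? (λ p → proj₁ p F.≟ j)

  Closes? : ∀ j ps → Dec (Closes j ps)
  Closes? j = Any.any? (λ p → proj₂ p F.≟ j)

  Opens-bound : ∀ {lo ps j} → AltFrom α lo ps → Opens j ps → lo ≤ toℕ j
  Opens-bound ((lo≤x , _) ∷ _)          (here refl) = lo≤x
  Opens-bound ((lo≤x , _ , x<y , _) ∷ rest) (there o) = ≤-trans lo≤x (<⇒≤ (<-trans x<y (Opens-bound rest o)))

  Closes-bound : ∀ {lo ps j} → AltFrom α lo ps → Closes j ps → lo ≤ toℕ j
  Closes-bound ((lo≤x , _ , x<y , _) ∷ _)    (here refl) = ≤-trans lo≤x (<⇒≤ x<y)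
  Closes-bound ((lo≤x , _ , x<y , _) ∷ rest) (there c)   = ≤-trans lo≤x (<⇒≤ (<-trans x<y (Closes-bound rest c)))

  Opens⇒ASide : ∀ {lo ps j} → AltFrom α lo ps → Opens j ps → ASide α j
  Opens⇒ASide ((_ , _ , _ , _ , s , _) ∷ _) (here refl) = s
  Opens⇒ASide (_ ∷ rest)                   (there o)   = Opens⇒ASide rest o

  Closes⇒BSide : ∀ {lo ps j} → AltFrom α lo ps → Closes j ps → BSide α j
  Closes⇒BSide ((_ , _ , _ , _ , _ , t) ∷ _) (here refl) = t
  Closes⇒BSide (_ ∷ rest)                   (there c)   = Closes⇒BSide rest c

  χ-Opens : ∀ {lo ps j} → AltFrom α lo ps → Opens j ps → χ ps j ≡ 1ℚ
  χ-Opens {ps = (x , y) ∷ _} ((_ , _ , x<y , _) ∷ rest) (here refl)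
    rewrite e-diag x | e-off (≢-sym (<⇒≢ᶠ x<y)) | χ-below rest x (<-trans x<y (n<1+n _)) = refl
  χ-Opens {ps = (x , y) ∷ _} ((_ , _ , x<y , _) ∷ rest) (there o)
    rewrite e-off (<⇒≢ᶠ (<-trans x<y (Opens-bound rest o))) | e-off (<⇒≢ᶠ (Opens-bound rest o)) | χ-Opens rest o = refl

  χ-Closes : ∀ {lo ps j} → AltFrom α lo ps → Closes j ps → χ ps j ≡ Q.- 1ℚ
  χ-Closes {ps = (x , y) ∷ _} ((_ , _ , x<y , _) ∷ rest) (here refl)
    rewrite e-diag y | e-off (<⇒≢ᶠ x<y) | χ-below rest y (n<1+n _) = refl
  χ-Closes {ps = (x , y) ∷ _} ((_ , _ , x<y , _) ∷ rest) (there c)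
    rewrite e-off (<⇒≢ᶠ (<-trans x<y (Closes-bound rest c))) | e-off (<⇒≢ᶠ (Closes-bound rest c)) | χ-Closes rest c = refl

  χ-neither : ∀ {lo ps j} → AltFrom α lo ps → ¬ Opens j ps → ¬ Closes j ps → χ ps j ≡ 0ℚ
  χ-neither [] _ _ = refl
  χ-neither (_ ∷ rest) ¬o ¬c
    rewrite e-off (¬o ∘ here) | e-off (¬c ∘ here) | χ-neither rest (¬o ∘ there) (¬c ∘ there) = refl

  Opens-Closes-between : ∀ {lo ps i i′} → AltFrom α lo ps → Opens i ps → Opens i′ ps → toℕ i < toℕ i′ →
                         ∃ λ q → Closes q ps × toℕ i < toℕ q × toℕ q < toℕ i′
  Opens-Closes-between (_ ∷ _) (here refl) (here refl) i<i = ⊥-elim (<-irrefl refl i<i)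
  Opens-Closes-between {ps = (x , y) ∷ _} ((_ , _ , x<y , _) ∷ rest) (here refl) (there o′) _ =
    y , here refl , x<y , Opens-bound rest o′
  Opens-Closes-between ((_ , _ , x<y , _) ∷ rest) (there o) (here refl) i<x =
    ⊥-elim (<-asym i<x (<-trans x<y (Opens-bound rest o)))
  Opens-Closes-between (_ ∷ rest) (there o) (there o′) i<i′ =
    let (q , c , l , u) = Opens-Closes-between rest o o′ i<i′ in q , there c , l , u

  Opens-Closes-after : ∀ {lo ps i} → AltFrom α lo ps → Opens i ps → ∃ λ q → Closes q ps × toℕ i < toℕ q
  Opens-Closes-after {ps = (x , y) ∷ _} ((_ , _ , x<y , _) ∷ _) (here refl) = y , here refl , x<y
  Opens-Closes-after (_ ∷ rest) (there o) = let (q , c , l) = Opens-Closes-after rest o in q , there c , l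

  Closes-Opens-before : ∀ {lo ps q} → AltFrom α lo ps → Closes q ps →
                        ∃ λ i → Opens i ps × toℕ i < toℕ q ×
                        (∀ q′ → Closes q′ ps → toℕ i < toℕ q′ → toℕ q′ < toℕ q → ⊥)
  Closes-Opens-before {ps = (x , y) ∷ _} ((_ , _ , x<y , _) ∷ rest) (here refl) = x , here refl , x<y , only-y
    where
    only-y : ∀ q′ → Closes q′ ((x , y) ∷ _) → toℕ x < toℕ q′ → toℕ q′ < toℕ y → ⊥
    only-y q′ (here refl) _ y<y = <-irrefl refl y<y
    only-y q′ (there c′)  _ q′<y = <-asym q′<y (Closes-bound rest c′)
  Closes-Opens-before {ps = (x , y) ∷ _} (_ ∷ rest) (there c) with Closes-Opens-before rest c
  ... | i , o , i<q , only = i , there o , i<q , only′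
    where
    only′ : ∀ q′ → Closes q′ ((x , y) ∷ _) → toℕ i < toℕ q′ → toℕ q′ < toℕ _ → ⊥
    only′ q′ (here refl) i<y _ = <-asym i<y (Opens-bound rest o)
    only′ q′ (there c′)  l u   = only q′ c′ l u

  module _ {ps : List (Fin n × Fin n)} (alt-ps : IsAltMatching α ps) where

    markᴹ : Fin n → Bool
    markᴹ j with Opens? j ps | Closes? j ps
    ... | yes _ | _     = true
    ... | no _  | yes _ = false
    ... | no _  | no _  = lookup (BbSet α) j

    Xᴹ : Subset n
    Xᴹ = Vec.tabulate markᴹ

    markᴹ-Opens : ∀ {j} → Opens j ps → markᴹ j ≡ true
    markᴹ-Opens {j} o with Opens? j ps | Closes? j ps
    ... | yes _ | _ = refl
    ... | no ¬o | _ = ⊥-elim (¬o o)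

    markᴹ-Closes : ∀ {j} → Closes j ps → markᴹ j ≡ false
    markᴹ-Closes {j} c with Opens? j ps | Closes? j ps
    ... | yes o | _     = ⊥-elim (ASide⇒¬BSide (Opens⇒ASide alt-ps o) (Closes⇒BSide alt-ps c))
    ... | no _  | yes _ = refl
    ... | no _  | no ¬c = ⊥-elim (¬c c)

    markᴹ-neither : ∀ {j} → ¬ Opens j ps → ¬ Closes j ps → markᴹ j ≡ lookup (BbSet α) j
    markᴹ-neither {j} ¬o ¬c with Opens? j ps | Closes? j ps
    ... | yes o | _     = ⊥-elim (¬o o)
    ... | no _  | yes c = ⊥-elim (¬c c)
    ... | no _  | no _  = refl

    ∈Xᴹ⇒markᴹ : ∀ {j} → j ∈ Xᴹ → markᴹ j ≡ true
    ∈Xᴹ⇒markᴹ {j} j∈ = trans (sym (lookup∘tabulate markᴹ j)) ([]=⇒lookup j∈)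

    Opens⇒∈Xᴹ : ∀ {j} → Opens j ps → j ∈ Xᴹ
    Opens⇒∈Xᴹ {j} o = lookup⇒[]= j Xᴹ (trans (lookup∘tabulate markᴹ j) (markᴹ-Opens o))

    Closes⇒∉Xᴹ : ∀ {j} → Closes j ps → j ∉ Xᴹ
    Closes⇒∉Xᴹ c j∈ = true≢false (trans (sym (∈Xᴹ⇒markᴹ j∈)) (markᴹ-Closes c))

    𝟏-Xᴹ-neither : ∀ {j} → ¬ Opens j ps → ¬ Closes j ps → 𝟏 Xᴹ j ≡ 𝟏 (BbSet α) j
    𝟏-Xᴹ-neither {j} ¬o ¬c =
      cong (λ x → Bool.if x then 1ℚ else 0ℚ) (trans (lookup∘tabulate markᴹ j) (markᴹ-neither ¬o ¬c))

    ∈Xᴹ-neither⇒∈BbSet : ∀ {j} → ¬ Opens j ps → ¬ Closes j ps → j ∈ Xᴹ → j ∈ BbSet α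
    ∈Xᴹ-neither⇒∈BbSet {j} ¬o ¬c j∈ =
      lookup⇒[]= j (BbSet α) (trans (sym (markᴹ-neither ¬o ¬c)) (∈Xᴹ⇒markᴹ j∈))

    ∈BbSet-neither⇒∈Xᴹ : ∀ {j} → ¬ Opens j ps → ¬ Closes j ps → j ∈ BbSet α → j ∈ Xᴹ
    ∈BbSet-neither⇒∈Xᴹ {j} ¬o ¬c j∈ =
      lookup⇒[]= j Xᴹ (trans (lookup∘tabulate markᴹ j) (trans (markᴹ-neither ¬o ¬c) ([]=⇒lookup j∈)))

    𝟏-Xᴹ : ∀ j → 𝟏 Xᴹ j ≡ χ ps j Q.+ 𝟏 (BbSet α) j
    𝟏-Xᴹ j with Opens? j ps | Closes? j ps
    ... | yes o | _
      rewrite 𝟏-∈ (Opens⇒∈Xᴹ o) | χ-Opens alt-ps o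
            | 𝟏-∉ (ASide⇒¬BSide (Opens⇒ASide alt-ps o) ∘ ∈BbSet⇒BSide) = refl
    ... | no _ | yes c
      rewrite 𝟏-∉ (Closes⇒∉Xᴹ c) | χ-Closes alt-ps c | 𝟏-∈ (BSide⇒∈BbSet (Closes⇒BSide alt-ps c)) = refl
    ... | no ¬o | no ¬c
      rewrite χ-neither alt-ps ¬o ¬c = trans (𝟏-Xᴹ-neither ¬o ¬c) (sym (QP.+-identityˡ _))

    Opener⇒Opens : ∀ {i} → Opener Xᴹ i → Opens i ps
    Opener⇒Opens {i} (s , i∈) with Opens? i ps | Closes? i ps
    ... | yes o | _     = o
    ... | no _  | yes c = ⊥-elim (Closes⇒∉Xᴹ c i∈)
    ... | no ¬o | no ¬c = ⊥-elim (ASide⇒¬BSide s (∈BbSet⇒BSide (∈Xᴹ-neither⇒∈BbSet ¬o ¬c i∈)))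

    Closer⇒Closes : ∀ {q} → Closer Xᴹ q → Closes q ps
    Closer⇒Closes {q} (t , q∉) with Opens? q ps | Closes? q ps
    ... | yes o | _     = ⊥-elim (ASide⇒¬BSide (Opens⇒ASide alt-ps o) t)
    ... | no _  | yes c = c
    ... | no ¬o | no ¬c = ⊥-elim (q∉ (∈BbSet-neither⇒∈Xᴹ ¬o ¬c (BSide⇒∈BbSet t)))

    Opens⇒Opener : ∀ {i} → Opens i ps → Opener Xᴹ i
    Opens⇒Opener o = Opens⇒ASide alt-ps o , Opens⇒∈Xᴹ o

    Closes⇒Closer : ∀ {q} → Closes q ps → Closer Xᴹ q
    Closes⇒Closer c = Closes⇒BSide alt-ps c , Closes⇒∉Xᴹ c

    Xᴹ-sides : ∀ {i} → i ∈ Xᴹ → ASide α i ⊎ BSide α i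
    Xᴹ-sides {i} i∈ with Opens? i ps | Closes? i ps
    ... | yes o | _     = inj₁ (Opens⇒ASide alt-ps o)
    ... | no _  | yes c = ⊥-elim (Closes⇒∉Xᴹ c i∈)
    ... | no ¬o | no ¬c = inj₂ (∈BbSet⇒BSide (∈Xᴹ-neither⇒∈BbSet ¬o ¬c i∈))

    Xᴹ-alternating : Alternating Xᴹ
    Xᴹ-alternating = record
      { sides          = Xᴹ-sides
      ; closer-between = λ o o′ i<i′ →
          let (q , c , l , u) = Opens-Closes-between alt-ps (Opener⇒Opens o) (Opener⇒Opens o′) i<i′
          in q , Closes⇒Closer c , l , u
      ; closer-after   = λ o → let (q , c , l) = Opens-Closes-after alt-ps (Opener⇒Opens o) in q , Closes⇒Closer c , l
      ; opener-before  = λ c → let (i , o , l , only) = Closes-Opens-before alt-ps (Closer⇒Closes c)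
                               in i , Opens⇒Opener o , l , λ q′ c′ → only q′ (Closer⇒Closes c′)
      }

basis⇒matching : ∀ {n} (α : Arc n) {X} → IsBasis α X →
                 Σ (List (Fin n × Fin n)) λ ps → IsAltMatching α ps × (∀ j → 𝟏 X j ≡ χ ps j Q.+ 𝟏 (BbSet α) j)
basis⇒matching α tree = Alternating⇒matching α (spanningTree⇒Alternating α tree)

matching⇒basis : ∀ {n} (α : Arc n) {ps} → IsAltMatching α ps →
                 Σ (Subset n) λ X → IsBasis α X × (∀ j → 𝟏 X j ≡ χ ps j Q.+ 𝟏 (BbSet α) j)
matching⇒basis α alt = Xᴹ α alt , Alternating⇒spanningTree α (Xᴹ-alternating α alt) , 𝟏-Xᴹ α alt

proposition72 : (n : ℕ) (α : Arc n) (x : Point n) →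
    MatroidPolytope α x ⇔ SPtrans α x
proposition72 n α x = mk⇔ to-SP from-SP
  where
  open +-*-Solver
  bb : Point n
  bb = 𝟏 (BbSet α)
  BasisVertex MatchingVertex : Point n → Set
  BasisVertex p    = Σ (Subset n) λ X → IsBasis α X × (∀ j → p j ≡ 𝟏 X j)
  MatchingVertex p = Σ (List (Fin n × Fin n)) λ ps → IsAltMatching α ps × (∀ j → p j ≡ χ ps j)

  basis-vertex : ∀ {p} → BasisVertex p → MatchingVertex (λ j → p j Q.+ Q.- bb j)
  basis-vertex {p} (X , tree , p≡) with basis⇒matching α tree
  ... | ps , alt , 𝟏X≡ = ps , alt , λ j →
        trans (cong (Q._+ Q.- bb j) (trans (p≡ j) (𝟏X≡ j)))
              (solve 2 (λ c b → (c :+ b) :+ :- b := c) refl (χ ps j) (bb j))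

  matching-vertex : ∀ {p} → MatchingVertex p → BasisVertex (λ j → p j Q.+ bb j)
  matching-vertex (ps , alt , p≡) with matching⇒basis α alt
  ... | X , tree , 𝟏X≡ = X , tree , λ j → trans (cong (Q._+ bb j) (p≡ j)) (sym (𝟏X≡ j))

  to-SP : MatroidPolytope α x → SPtrans α x
  to-SP conv = (λ j → x j Q.+ Q.- bb j)
             , Conv-translate {S = BasisVertex} (λ j → Q.- bb j) basis-vertex conv (λ _ → refl)
             , λ j → solve 2 (λ x b → x := (x :+ :- b) :+ b) refl (x j) (bb j)

  from-SP : SPtrans α x → MatroidPolytope α x
  from-SP (y , conv , x≡) = Conv-translate {S = MatchingVertex} bb matching-vertex conv x≡
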